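{- Let $F=GF(8)$, $\alpha$ a primitive element, $\alpha^{ -\infty}=0$, and let $l\neq k$ be elements of $\{ -\infty,0,1,\dots,6\}$. Then the graph $G_{k,l}$ is connected.
   Context: Binary vectors of length $8$ have coordinates indexed by elements of $F$ and are identified with their supports $X\subseteq F$. For $a\in F$, $H_a=\{X\subseteq F: |X|\text{ odd},\ \sum_{x\in X}(x+a)^3=0\}$. The graph $G_{k,l}$ has vertex set $H_{\alpha^k}\cup H_{\alpha^l}$ and edge set $\{\{X,X'\}: X\in H_{\alpha^k},\ X'\in H_{\alpha^l},\ d(X,X')=2\}$, where $d$ is Hamming distance. -}

module Defs where

open import Data.Bool using (Bool; true; false; _xor_; _∧_; if_then_else_)
open import Data.Product using (_×_; _,_; ∃-syntax)
open import Data.Nat using (ℕ; zero; suc; _+_; _%_)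
open import Data.Fin using (Fin)
open import Data.Fin.Subset using (Subset; ∣_∣)
open import Data.Maybe using (Maybe; just; nothing)
open import Data.Vec using (Vec; []; _∷_; lookup; zipWith; foldr; allFin)
open import Relation.Binary.PropositionalEquality using (_≡_)
open import Relation.Nullary using (¬_)
open import Data.Sum using (_⊎_)
open import Relation.Binary.Construct.Closure.ReflexiveTransitive using (Star)

-- GF(8) = GF(2)[x]/(x³ + x + 1); (a₀ , a₁ , a₂) represents a₀ + a₁x + a₂x².
F : Set
F = Bool × Bool × Bool

0F 1F : F
0F = false , false , false
1F = true , false , false

_+F_ : F → F → F
(a₀ , a₁ , a₂) +F (b₀ , b₁ , b₂) = (a₀ xor b₀) , (a₁ xor b₁) , (a₂ xor b₂)

-- multiplication by x, using x³ = x + 1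
xtimes : F → F
xtimes (a₀ , a₁ , a₂) = a₂ , (a₀ xor a₂) , a₁

scale : Bool → F → F
scale c a = if c then a else 0F

_*F_ : F → F → F
a *F (b₀ , b₁ , b₂) = scale b₀ a +F (scale b₁ (xtimes a) +F scale b₂ (xtimes (xtimes a)))

_^F_ : F → ℕ → F
a ^F zero = 1F
a ^F suc n = a *F (a ^F n)

cube : F → F
cube a = a *F (a *F a)

Primitive : F → Set
Primitive α = (y : F) → ¬ (y ≡ 0F) → ∃[ n ] (α ^F n ≡ y)

-- exponents in {-∞,0,1,…,6}: nothing = -∞, with α^{-∞} = 0
Exp : Set
Exp = Maybe (Fin 7)

pow : F → Exp → F
pow α nothing = 0F
pow α (just i) = α ^F Data.Fin.toℕ i

-- A fixed enumeration of the 8 field elements; coordinate i of a binary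
-- vector of length 8 is indexed by the field element elems[i].
elems : Vec F 8
elems = (false , false , false) ∷ (true , false , false) ∷ (false , true , false) ∷ (true , true , false)
      ∷ (false , false , true) ∷ (true , false , true) ∷ (false , true , true) ∷ (true , true , true) ∷ []

elem : Fin 8 → F
elem i = lookup elems i

-- binary vectors of length 8 = subsets of F (via elem)
Word : Set
Word = Subset 8

cubeSum : F → Word → F
cubeSum a X = foldr (λ _ → F) _+F_ 0F
  (zipWith (λ b i → if b then cube (elem i +F a) else 0F) X (allFin 8))

H : F → Word → Set
H a X = (∣ X ∣ % 2 ≡ 1) × (cubeSum a X ≡ 0F)

dist : Word → Word → ℕ
dist X Y = foldr (λ _ → ℕ) (λ b n → (if b then 1 else 0) + n) 0 (zipWith _xor_ X Y)

Vertex : F → Exp → Exp → Word → Set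
Vertex α k l X = H (pow α k) X ⊎ H (pow α l) X

Edge : F → Exp → Exp → Word → Word → Set
Edge α k l X Y =
  ((H (pow α k) X × H (pow α l) Y) ⊎ (H (pow α k) Y × H (pow α l) X)) × (dist X Y ≡ 2)

Connected : F → Exp → Exp → Set
Connected α k l = (X Y : Word) → Vertex α k l X → Vertex α k l Y → Star (Edge α k l) X Y

-- The multiplicative group of GF(8) has prime order 7, so every element other than 0 and 1
-- is primitive and k ↦ αᵏ is injective on {-∞,0,…,6}.  It therefore suffices that for any
-- two distinct a, b ∈ F the graph joining H_a and H_b by distance-2 edges is connected.
-- That is a finite check: from the singleton {a} ∈ H_a a breadth-first search reaches
-- every vertex within four steps, and since the edge relation is symmetric, paths to {a}
-- can be reversed and concatenated.
module Submission where

open import Defs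
open import Data.Bool using (Bool; true; false; T; if_then_else_)
open import Data.Bool.Properties using (xor-comm) renaming (_≟_ to _≟B_)
import Data.Fin.Properties as Fin
open import Data.Fin.Subset using (Subset; inside; outside; ∣_∣)
open import Data.List using (List; []; _∷_; mapMaybe; concatMap; filter)
open import Data.Maybe using (Maybe; just; nothing; is-just; to-witness-T)
import Data.Maybe as Maybe
import Data.Maybe.Properties as Maybe
open import Data.Nat using (ℕ; zero; suc; _+_; _%_)
import Data.Nat.Properties as ℕ
open import Data.Product using (Σ; _×_; _,_; proj₁; proj₂)
open import Data.Product.Properties using (≡-dec)
open import Data.Sum using (_⊎_)
import Data.Sum as Sum
open import Data.Vec using ([]; _∷_; tabulate; foldr)
import Data.Vec.Properties as Vec
open import Function using (_∘_)
open import Relation.Binary using (Rel; Decidable; DecidableEquality; Symmetric)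
open import Relation.Binary.Construct.Closure.ReflexiveTransitive using (Star; ε; _◅_; _◅◅_; reverse)
open import Relation.Binary.PropositionalEquality using (_≡_; _≢_; refl; sym; trans; cong)
open import Relation.Nullary using (Dec; yes; no; does)
open import Relation.Nullary.Decidable using (map′; from-yes; _×-dec_; _⊎-dec_; _→-dec_; ¬?; T?)
open import Relation.Unary using (Pred)

all-Bool? : ∀ {ℓ} {P : Pred Bool ℓ} → (∀ b → Dec (P b)) → Dec (∀ b → P b)
all-Bool? P? = map′ (λ { (t , f) true → t ; (t , f) false → f }) (λ p → p true , p false)
                    (P? true ×-dec P? false)

all-F? : ∀ {ℓ} {P : Pred F ℓ} → (∀ a → Dec (P a)) → Dec (∀ a → P a)
all-F? P? = map′ (λ p (a₀ , a₁ , a₂) → p a₀ a₁ a₂) (λ p a₀ a₁ a₂ → p (a₀ , a₁ , a₂))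
                 (all-Bool? λ a₀ → all-Bool? λ a₁ → all-Bool? λ a₂ → P? (a₀ , a₁ , a₂))

all-Subset? : ∀ {n ℓ} {P : Pred (Subset n) ℓ} → (∀ X → Dec (P X)) → Dec (∀ X → P X)
all-Subset? {zero}  P? = map′ (λ { p [] → p }) (λ p → p []) (P? [])
all-Subset? {suc n} P? =
  map′ (λ { (p , q) (true ∷ X) → p X ; (p , q) (false ∷ X) → q X })
       (λ p → p ∘ (inside ∷_) , p ∘ (outside ∷_))
       (all-Subset? (P? ∘ (inside ∷_)) ×-dec all-Subset? (P? ∘ (outside ∷_)))

all-Exp? : ∀ {ℓ} {P : Pred Exp ℓ} → (∀ k → Dec (P k)) → Dec (∀ k → P k)
all-Exp? P? = map′ (λ { (p , q) nothing → p ; (p , q) (just i) → q i }) (λ p → p nothing , p ∘ just)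
                   (P? nothing ×-dec Fin.all? (P? ∘ just))

subsets : (n : ℕ) → List (Subset n)
subsets zero    = [] ∷ []
subsets (suc n) = concatMap (λ X → (inside ∷ X) ∷ (outside ∷ X) ∷ []) (subsets n)

_≟F_ : DecidableEquality F
_≟F_ = ≡-dec _≟B_ (≡-dec _≟B_ _≟B_)

_≟E_ : DecidableEquality Exp
_≟E_ = Maybe.≡-dec Fin._≟_

*F-zeroˡ : ∀ b → 0F *F b ≡ 0F
*F-zeroˡ (false , false , false) = refl
*F-zeroˡ (false , false , true)  = refl
*F-zeroˡ (false , true  , false) = refl
*F-zeroˡ (false , true  , true)  = refl
*F-zeroˡ (true  , false , false) = refl
*F-zeroˡ (true  , false , true)  = refl
*F-zeroˡ (true  , true  , false) = refl
*F-zeroˡ (true  , true  , true)  = refl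

^F-zeroˡ : ∀ n → 1F ^F n ≡ 1F
^F-zeroˡ zero    = refl
^F-zeroˡ (suc n) = cong (1F *F_) (^F-zeroˡ n)

primitive⇒≢0F : ∀ {α} → Primitive α → α ≢ 0F
primitive⇒≢0F prim refl with prim (false , true , false) (λ ())
... | zero  , ()
... | suc n , 0ⁿ⁺¹≡x with trans (sym (*F-zeroˡ (0F ^F n))) 0ⁿ⁺¹≡x
...   | ()

primitive⇒≢1F : ∀ {α} → Primitive α → α ≢ 1F
primitive⇒≢1F prim refl with prim (false , true , false) (λ ())
... | n , 1ⁿ≡x with trans (sym (^F-zeroˡ n)) 1ⁿ≡x
...   | ()

PowInjective : F → Set
PowInjective α = ∀ k l → pow α k ≡ pow α l → k ≡ l

pow-injective : ∀ α → α ≢ 0F → α ≢ 1F → PowInjective α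
pow-injective = from-yes
  (all-F? λ α → ¬? (α ≟F 0F) →-dec ¬? (α ≟F 1F) →-dec
     all-Exp? λ k → all-Exp? λ l → (pow α k ≟F pow α l) →-dec (k ≟E l))

module BreadthFirst {V : Set} {ℓ} {E : Rel V ℓ} (E? : Decidable E) (candidates : List V) (root : V) where

  ToRoot : Pred V ℓ
  ToRoot X = Star E X root

  viaNeighbour : (X : V) → List (Σ V ToRoot) → Maybe (ToRoot X)
  viaNeighbour X []            = nothing
  viaNeighbour X ((Y , p) ∷ L) with E? X Y
  ... | yes e = just (e ◅ p)
  ... | no _  = viaNeighbour X L

  -- The list is an argument rather than a recursive call so that the evaluator shares it
  -- across all candidates.
  grow : List (Σ V ToRoot) → List (Σ V ToRoot)
  grow L = (root , ε) ∷ mapMaybe (λ X → Maybe.map (X ,_) (viaNeighbour X L)) candidates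

  ball : ℕ → List (Σ V ToRoot)
  ball zero    = (root , ε) ∷ []
  ball (suc n) = grow (ball n)

  Covers : ∀ {p} → Pred V p → List (Σ V ToRoot) → Set p
  Covers P L = ∀ X → P X → T (is-just (viaNeighbour X L))

  covers⇒connected : ∀ {p} {P : Pred V p} {L} → Symmetric E → Covers P L →
                     ∀ X Y → P X → P Y → Star E X Y
  covers⇒connected {P = P} E-sym covers X Y x y = toRoot X x ◅◅ reverse E-sym (toRoot Y y)
    where
    toRoot : ∀ Z → P Z → ToRoot Z
    toRoot Z z = to-witness-T _ (covers Z z)

dist-comm : ∀ X Y → dist X Y ≡ dist Y X
dist-comm X Y = cong (foldr (λ _ → ℕ) (λ b n → (if b then 1 else 0) + n) 0) (Vec.zipWith-comm xor-comm X Y)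

H? : ∀ a X → Dec (H a X)
H? a X = (∣ X ∣ % 2 ℕ.≟ 1) ×-dec (cubeSum a X ≟F 0F)

VertexBetween : F → F → Pred Word _
VertexBetween a b X = H a X ⊎ H b X

VertexBetween? : ∀ a b X → Dec (VertexBetween a b X)
VertexBetween? a b X = H? a X ⊎-dec H? b X

Adjacent : F → F → Rel Word _
Adjacent a b X Y = ((H a X × H b Y) ⊎ (H a Y × H b X)) × (dist X Y ≡ 2)

Adjacent? : ∀ a b → Decidable (Adjacent a b)
Adjacent? a b X Y with dist X Y ℕ.≟ 2
... | no  d≢2 = no (d≢2 ∘ proj₂)
... | yes d≡2 = map′ (_, d≡2) proj₁ ((H? a X ×-dec H? b Y) ⊎-dec (H? a Y ×-dec H? b X))

adjacent-sym : ∀ a b → Symmetric (Adjacent a b)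
adjacent-sym a b {X} {Y} (edge , d) = Sum.swap edge , trans (dist-comm Y X) d

ConnectedBetween : F → F → Set
ConnectedBetween a b = ∀ X Y → VertexBetween a b X → VertexBetween a b Y → Star (Adjacent a b) X Y

singleton : F → Word
singleton a = tabulate (λ i → does (elem i ≟F a))

module Search (a b : F) =
  BreadthFirst (Adjacent? a b) (filter (VertexBetween? a b) (subsets 8)) (singleton a)

-- Every vertex lies within distance 4 of {a}, hence has a neighbour in the 3-ball.
ball₃-covers : ∀ a b → a ≢ b → Search.Covers a b (VertexBetween a b) (Search.ball a b 3)
ball₃-covers = from-yes
  (all-F? λ a → all-F? λ b → ¬? (a ≟F b) →-dec covers? a b (Search.ball a b 3))
  where
  covers? : ∀ a b L → Dec (Search.Covers a b (VertexBetween a b) L)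
  covers? a b L = all-Subset? λ X → VertexBetween? a b X →-dec T? (is-just (Search.viaNeighbour a b X L))

connected-between : ∀ a b → a ≢ b → ConnectedBetween a b
connected-between a b a≢b =
  Search.covers⇒connected a b (λ {X} {Y} → adjacent-sym a b {X} {Y}) (ball₃-covers a b a≢b)

mainTheorem10 : (α : F) → Primitive α → (k l : Exp) → l ≢ k → Connected α k l
mainTheorem10 α prim k l l≢k = connected-between (pow α k) (pow α l) αᵏ≢αˡ
  where
  αᵏ≢αˡ : pow α k ≢ pow α l
  αᵏ≢αˡ = l≢k ∘ sym ∘ pow-injective α (primitive⇒≢0F prim) (primitive⇒≢1F prim) k l
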